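{- Let $k\ge 2$ be an integer and let $\mathcal{F}\subseteq\binom{[n]}{k}$ be an intersecting family with $$n\ \ge\ k+\left\lceil\frac{\sqrt{8k+1}-1}{2}\right\rceil+2$$ and $\delta_{k-1}(\mathcal{F})\ge 1$. Let $e\in\mathcal{F}$. Then there exists a subfamily $\mathcal{H}\subseteq\mathcal{F}$ with $e\in\mathcal{H}$ such that $$\left|\bigcap_{f\in\mathcal{H}} f\right|\le 1\qquad\text{and}\qquad |V(\mathcal{H})|\le k+\left\lceil\frac{\sqrt{8k+1}-1}{2}\right\rceil+2.$$
   Context: $\binom{[n]}{k}$ is the family of all $k$-subsets of $[n]=\{1,\dots,n\}$. A family is intersecting if any two of its members intersect. For $S\subseteq[n]$, $d_{\mathcal{F}}(S)$ is the number of members of $\mathcal{F}$ containing $S$, and $\delta_{k-1}(\mathcal{F})$ is the minimum of $d_{\mathcal{F}}(S)$ over all $(k-1)$-subsets $S\subseteq[n]$. For a subfamily $\mathcal{H}$, $V(\mathcal{H})=\bigcup_{f\in\mathcal{H}} f$. -}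

module Defs where

open import Data.Nat using (ℕ; _+_; _*_; _≤_; _∸_)
open import Data.Fin.Subset using (Subset; _⊆_; _∩_; ∣_∣; Nonempty)
open import Data.Fin.Subset.Properties using (_⊆?_)
open import Data.List using (List; filter; length)
open import Data.List.Membership.Propositional using (_∈_)
open import Data.List.Relation.Unary.All using (All)
open import Data.List.Relation.Unary.Unique.Propositional using (Unique)
open import Data.Product using (_×_)
open import Relation.Binary.PropositionalEquality using (_≡_)

record Family (n : ℕ) : Set where
  constructor family
  field
    members : List (Subset n)
    distinct : Unique members
open Family public

Uniform : ∀ {n} → ℕ → Family n → Set
Uniform k F = All (λ f → ∣ f ∣ ≡ k) (members F)

Intersecting : ∀ {n} → Family n → Set
Intersecting F = ∀ {f g} → f ∈ members F → g ∈ members F → Nonempty (f ∩ g)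

degree : ∀ {n} → Family n → Subset n → ℕ
degree F S = length (filter (S ⊆?_) (members F))

MinCodegreeAtLeast : ∀ {n} → ℕ → Family n → ℕ → Set
MinCodegreeAtLeast {n} k F m =
  (S : Subset n) → ∣ S ∣ ≡ (k ∸ 1) → m ≤ degree F S

-- t = ⌈ (√(8k+1) − 1) / 2 ⌉, i.e. t is the least natural number with
-- (√(8k+1) − 1)/2 ≤ t, equivalently √(8k+1) ≤ 2t+1, i.e. 8k+1 ≤ (2t+1)².
IsCeilTri : ℕ → ℕ → Set
IsCeilTri k t =
  (8 * k + 1 ≤ (2 * t + 1) * (2 * t + 1)) ×
  (∀ s → 8 * k + 1 ≤ (2 * s + 1) * (2 * s + 1) → t ≤ s)

module Submission where

-- Greedy construction. Keep H ∋ e together with a set V ⊇ ⋃ H of size k + 1 + m,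
-- starting from H = {e} and V = e plus one point. Pick a (k − 1)-set S ⊆ V that
-- either misses I = ⋂ H or contains V ∖ I, and add to H a member f ⊇ S, which
-- exists because S has positive codegree; since S ⊆ f ∩ V, the set f ∪ V has at
-- most one point more than V. If S misses I, then |f ∩ I| ≤ |f ∖ S| = 1 and we
-- stop. Otherwise f ∪ V = f ∪ I, so |f ∩ I| + |f ∪ V| = k + |I|: the intersection
-- loses at least m + 1 points if V does not grow and m + 2 if it does. This keeps
-- 2|⋂ H| + m(m + 1) ≤ 2k, hence m(m + 1) ≤ 2k ≤ t(t + 1), i.e. m ≤ t, and at the
-- stop |⋃ H| ≤ k + m + 2 ≤ k + t + 2.

open import Defs
open import Data.Nat using (ℕ; suc; _+_; _*_; _∸_; _≤_; _<_; z≤n; s≤s; z<s)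
open import Data.Nat.Properties
open import Data.Nat.Induction using (<-wellFounded)
open import Data.Nat.Tactic.RingSolver using (solve-∀)
open import Data.Fin.Subset
  using (Subset; ∣_∣; ⋂; ⋃; _∩_; _∪_; ∁; _⊆_; ⊤; ⊥; Empty; inside; outside)
open import Data.Fin.Subset.Properties
open import Data.List using (List; []; _∷_; filter)
open import Data.List.Membership.Propositional using (_∈_)
open import Data.List.Membership.Propositional.Properties using (∈-filter⁻)
open import Data.List.Relation.Unary.Any using (here; there)
open import Data.List.Relation.Unary.All using (All; []; _∷_)
import Data.List.Relation.Unary.All as All
open import Data.Product using (Σ; ∃; ∃₂; _×_; _,_)
open import Data.Sum using (_⊎_; inj₁; inj₂; [_,_]′)
open import Data.Vec using ([]; _∷_)
import Data.Vec as Vec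
open import Induction.WellFounded using (Acc; acc)
open import Relation.Binary.PropositionalEquality
  using (_≡_; refl; sym; trans; cong; subst; subst₂; module ≡-Reasoning)
open import Relation.Nullary using (yes; no; contradiction)

∣p∪q∣+∣p∩q∣≡∣p∣+∣q∣ : ∀ {n} (p q : Subset n) → ∣ p ∪ q ∣ + ∣ p ∩ q ∣ ≡ ∣ p ∣ + ∣ q ∣
∣p∪q∣+∣p∩q∣≡∣p∣+∣q∣ []            []            = refl
∣p∪q∣+∣p∩q∣≡∣p∣+∣q∣ (outside ∷ p) (outside ∷ q) = ∣p∪q∣+∣p∩q∣≡∣p∣+∣q∣ p q
∣p∪q∣+∣p∩q∣≡∣p∣+∣q∣ (outside ∷ p) (inside ∷ q) =
  trans (cong suc (∣p∪q∣+∣p∩q∣≡∣p∣+∣q∣ p q)) (sym (+-suc ∣ p ∣ ∣ q ∣))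
∣p∪q∣+∣p∩q∣≡∣p∣+∣q∣ (inside ∷ p)  (outside ∷ q) = cong suc (∣p∪q∣+∣p∩q∣≡∣p∣+∣q∣ p q)
∣p∪q∣+∣p∩q∣≡∣p∣+∣q∣ (inside ∷ p)  (inside ∷ q)  = cong suc (begin
  ∣ p ∪ q ∣ + suc ∣ p ∩ q ∣  ≡⟨ +-suc ∣ p ∪ q ∣ ∣ p ∩ q ∣ ⟩
  suc (∣ p ∪ q ∣ + ∣ p ∩ q ∣) ≡⟨ cong suc (∣p∪q∣+∣p∩q∣≡∣p∣+∣q∣ p q) ⟩
  suc (∣ p ∣ + ∣ q ∣)         ≡⟨ sym (+-suc ∣ p ∣ ∣ q ∣) ⟩
  ∣ p ∣ + suc ∣ q ∣           ∎)
  where open ≡-Reasoning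

∪-lub : ∀ {n} {p q s : Subset n} → p ⊆ s → q ⊆ s → p ∪ q ⊆ s
∪-lub {p = p} {q} p⊆s q⊆s x∈p∪q = [ p⊆s , q⊆s ]′ (x∈p∪q⁻ p q x∈p∪q)

∩-glb : ∀ {n} {p q s : Subset n} → s ⊆ p → s ⊆ q → s ⊆ p ∩ q
∩-glb s⊆p s⊆q x∈s = x∈p∩q⁺ (s⊆p x∈s , s⊆q x∈s)

∃-⊆-between : ∀ {n r} {p q : Subset n} → p ⊆ q → ∣ p ∣ ≤ r → r ≤ ∣ q ∣ →
  ∃ λ s → p ⊆ s × s ⊆ q × ∣ s ∣ ≡ r
∃-⊆-between {p = []} {[]} _ z≤n z≤n = [] , (λ ()) , (λ ()) , refl
∃-⊆-between {p = inside ∷ p} {outside ∷ q} p⊆q _ _ with p⊆q Vec.here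
... | ()
∃-⊆-between {p = inside ∷ p} {inside ∷ q} p⊆q (s≤s p≤r) (s≤s r≤q)
  with ∃-⊆-between (drop-∷-⊆ p⊆q) p≤r r≤q
... | s , p⊆s , s⊆q , ∣s∣≡r = inside ∷ s , in⊆in p⊆s , in⊆in s⊆q , cong suc ∣s∣≡r
∃-⊆-between {p = outside ∷ p} {outside ∷ q} p⊆q p≤r r≤q
  with ∃-⊆-between (drop-∷-⊆ p⊆q) p≤r r≤q
... | s , p⊆s , s⊆q , ∣s∣≡r = outside ∷ s , out⊆ p⊆s , out⊆ s⊆q , ∣s∣≡r
∃-⊆-between {r = r} {outside ∷ p} {inside ∷ q} p⊆q p≤r r≤1+q with r ≤? ∣ q ∣
... | yes r≤q with ∃-⊆-between (drop-∷-⊆ p⊆q) p≤r r≤q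
...   | s , p⊆s , s⊆q , ∣s∣≡r = outside ∷ s , out⊆ p⊆s , out⊆ s⊆q , ∣s∣≡r
∃-⊆-between {r = r} {outside ∷ p} {inside ∷ q} p⊆q p≤r r≤1+q | no r≰q =
  inside ∷ q , out⊆ (drop-∷-⊆ p⊆q) , ⊆-refl , ≤-antisym (≰⇒> r≰q) r≤1+q

∃-⊆-avoiding⊎covering : ∀ {n} r (V I : Subset n) → r ≤ ∣ V ∣ →
  ∃ λ S → S ⊆ V × ∣ S ∣ ≡ r × (S ⊆ ∁ I ⊎ V ∩ ∁ I ⊆ S)
∃-⊆-avoiding⊎covering {n} r V I r≤∣V∣ with r ≤? ∣ V ∩ ∁ I ∣
... | yes r≤∣V∖I∣ with ∃-⊆-between ⊥⊆ (subst (_≤ r) (sym (∣⊥∣≡0 n)) z≤n) r≤∣V∖I∣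
...   | S , _ , S⊆V∖I , ∣S∣≡r =
  S , ⊆-trans S⊆V∖I (p∩q⊆p V (∁ I)) , ∣S∣≡r , inj₁ (⊆-trans S⊆V∖I (p∩q⊆q V (∁ I)))
∃-⊆-avoiding⊎covering r V I r≤∣V∣ | no r≰∣V∖I∣
  with ∃-⊆-between (p∩q⊆p V (∁ I)) (<⇒≤ (≰⇒> r≰∣V∖I∣)) r≤∣V∣
... | S , V∖I⊆S , S⊆V , ∣S∣≡r = S , S⊆V , ∣S∣≡r , inj₂ V∖I⊆S

disjoint⇒∣p∣+∣q∣≤∣s∣ : ∀ {n} {p q s : Subset n} → p ⊆ s → q ⊆ s → q ⊆ ∁ p →
  ∣ p ∣ + ∣ q ∣ ≤ ∣ s ∣
disjoint⇒∣p∣+∣q∣≤∣s∣ {n} {p} {q} {s} p⊆s q⊆s q⊆∁p = begin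
  ∣ p ∣ + ∣ q ∣          ≡⟨ sym (∣p∪q∣+∣p∩q∣≡∣p∣+∣q∣ p q) ⟩
  ∣ p ∪ q ∣ + ∣ p ∩ q ∣  ≡⟨ cong (λ x → ∣ p ∪ q ∣ + ∣ x ∣) (Empty-unique p∩q-empty) ⟩
  ∣ p ∪ q ∣ + ∣ ⊥ {n} ∣  ≡⟨ cong (∣ p ∪ q ∣ +_) (∣⊥∣≡0 n) ⟩
  ∣ p ∪ q ∣ + 0          ≡⟨ +-identityʳ _ ⟩
  ∣ p ∪ q ∣              ≤⟨ p⊆q⇒∣p∣≤∣q∣ (∪-lub p⊆s q⊆s) ⟩
  ∣ s ∣                  ∎
  where
  open ≤-Reasoning
  p∩q-empty : Empty (p ∩ q)
  p∩q-empty (_ , x∈p∩q) with x∈p∩q⁻ p q x∈p∩q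
  ... | x∈p , x∈q = x∈∁p⇒x∉p (q⊆∁p x∈q) x∈p

∣p∪q∣+∣s∣≤∣p∣+∣q∣ : ∀ {n} {p q s : Subset n} → s ⊆ p → s ⊆ q →
  ∣ p ∪ q ∣ + ∣ s ∣ ≤ ∣ p ∣ + ∣ q ∣
∣p∪q∣+∣s∣≤∣p∣+∣q∣ {p = p} {q} s⊆p s⊆q =
  ≤-trans (+-monoʳ-≤ ∣ p ∪ q ∣ (p⊆q⇒∣p∣≤∣q∣ (∩-glb s⊆p s⊆q)))
          (≤-reflexive (∣p∪q∣+∣p∩q∣≡∣p∣+∣q∣ p q))

∣s∩q∣+∣s∪p∣≤∣s∣+∣q∣ : ∀ {n} {p q s : Subset n} → p ∩ ∁ q ⊆ s →
  ∣ s ∩ q ∣ + ∣ s ∪ p ∣ ≤ ∣ s ∣ + ∣ q ∣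
∣s∩q∣+∣s∪p∣≤∣s∣+∣q∣ {p = p} {q} {s} p∖q⊆s = begin
  ∣ s ∩ q ∣ + ∣ s ∪ p ∣ ≤⟨ +-monoʳ-≤ ∣ s ∩ q ∣ (p⊆q⇒∣p∣≤∣q∣ s∪p⊆s∪q) ⟩
  ∣ s ∩ q ∣ + ∣ s ∪ q ∣ ≡⟨ +-comm ∣ s ∩ q ∣ _ ⟩
  ∣ s ∪ q ∣ + ∣ s ∩ q ∣ ≡⟨ ∣p∪q∣+∣p∩q∣≡∣p∣+∣q∣ s q ⟩
  ∣ s ∣ + ∣ q ∣         ∎
  where
  open ≤-Reasoning
  s∪p⊆s∪q : s ∪ p ⊆ s ∪ q
  s∪p⊆s∪q {x} x∈s∪p with x∈p∪q⁻ s p x∈s∪p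
  ... | inj₁ x∈s = x∈p∪q⁺ (inj₁ x∈s)
  ... | inj₂ x∈p with x ∈? q
  ...   | yes x∈q = x∈p∪q⁺ (inj₂ x∈q)
  ...   | no  x∉q = x∈p∪q⁺ (inj₁ (p∖q⊆s (x∈p∩q⁺ (x∈p , x∉p⇒x∈∁p x∉q))))

∃-member-⊇ : ∀ {n k} {F : Family n} → MinCodegreeAtLeast k F 1 →
  (S : Subset n) → ∣ S ∣ ≡ k ∸ 1 → ∃ λ f → f ∈ members F × S ⊆ f
∃-member-⊇ {F = F} codegree S ∣S∣≡
  with filter (S ⊆?_) (members F) in eq | codegree S ∣S∣≡
... | f ∷ _ | _ = f , ∈-filter⁻ (S ⊆?_) {xs = members F} (subst (f ∈_) (sym eq) (here refl))

8k+1≤[2t+1]²⇒2k≤t[1+t] : ∀ k t → 8 * k + 1 ≤ (2 * t + 1) * (2 * t + 1) → 2 * k ≤ t * suc t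
8k+1≤[2t+1]²⇒2k≤t[1+t] k t h =
  *-cancelˡ-≤ 4 (+-cancelʳ-≤ 1 _ _ (subst₂ _≤_ (8k≡4[2k] k) ([2t+1]²≡4t[1+t]+1 t) h))
  where
  8k≡4[2k] : ∀ k → 8 * k + 1 ≡ 4 * (2 * k) + 1
  8k≡4[2k] = solve-∀
  [2t+1]²≡4t[1+t]+1 : ∀ t → (2 * t + 1) * (2 * t + 1) ≡ 4 * (t * suc t) + 1
  [2t+1]²≡4t[1+t]+1 = solve-∀

m[1+m]≤n[1+n]⇒m≤n : ∀ {m n} → m * suc m ≤ n * suc n → m ≤ n
m[1+m]≤n[1+n]⇒m≤n {m} {n} h with m ≤? n
... | yes m≤n = m≤n
... | no  m≰n = contradiction h (<⇒≱ (*-mono-< (≰⇒> m≰n) (s≤s (≰⇒> m≰n))))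

m+[n+1+k]≤k+o⇒m+1+n≤o : ∀ {m o k} n → m + (n + suc k) ≤ k + o → m + suc n ≤ o
m+[n+1+k]≤k+o⇒m+1+n≤o {m} {o} {k} n h = +-cancelˡ-≤ k _ _ (subst (_≤ k + o) (regroup m n k) h)
  where
  regroup : ∀ m n k → m + (n + suc k) ≡ k + (m + suc n)
  regroup = solve-∀

budget-step : ∀ {k m i i′ v′} → m + suc k ≤ v′ → v′ ≤ suc m + suc k → i′ + v′ ≤ k + i →
  2 * i + m * suc m ≤ 2 * k →
  ∃ λ m′ → v′ ≡ m′ + suc k × i′ < i × 2 * i′ + m′ * suc m′ ≤ 2 * k
budget-step {k} {m} {i} {i′} v≤v′ v′≤1+v shrink budget with m≤n⇒m<n∨m≡n v≤v′
... | inj₂ refl = m , refl , i′<i , (begin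
  2 * i′ + m * suc m ≤⟨ +-monoˡ-≤ (m * suc m) (*-monoʳ-≤ 2 (<⇒≤ i′<i)) ⟩
  2 * i + m * suc m  ≤⟨ budget ⟩
  2 * k              ∎)
  where
  open ≤-Reasoning
  i′<i : i′ < i
  i′<i = <-≤-trans (m<m+n i′ z<s) (m+[n+1+k]≤k+o⇒m+1+n≤o m shrink)
... | inj₁ v<v′ with ≤-antisym v′≤1+v v<v′
... | refl = suc m , refl , <-≤-trans (m<m+n i′ z<s) i′+2+m≤i , (begin
  2 * i′ + suc m * suc (suc m)     ≤⟨ m≤m+n _ 2 ⟩
  2 * i′ + suc m * suc (suc m) + 2 ≡⟨ regroup i′ m ⟩
  2 * (i′ + suc (suc m)) + m * suc m ≤⟨ +-monoˡ-≤ (m * suc m) (*-monoʳ-≤ 2 i′+2+m≤i) ⟩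
  2 * i + m * suc m                 ≤⟨ budget ⟩
  2 * k                             ∎)
  where
  open ≤-Reasoning
  i′+2+m≤i : i′ + suc (suc m) ≤ i
  i′+2+m≤i = m+[n+1+k]≤k+o⇒m+1+n≤o (suc m) shrink
  regroup : ∀ i′ m → 2 * i′ + suc m * suc (suc m) + 2 ≡ 2 * (i′ + suc (suc m)) + m * suc m
  regroup = solve-∀

module Greedy {n r t : ℕ} (F : Family n) (uniform : Uniform (suc r) F)
              (codegree : MinCodegreeAtLeast (suc r) F 1) (2k≤t[1+t] : 2 * suc r ≤ t * suc t)
              {e : Subset n} (e∈F : e ∈ members F) where

  k : ℕ
  k = suc r

  Result : Set
  Result = ∃ λ H → All (_∈ members F) H × e ∈ H × ∣ ⋂ H ∣ ≤ 1 × ∣ ⋃ H ∣ ≤ k + t + 2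

  record Cover (m : ℕ) : Set where
    constructor cover
    field
      H      : List (Subset n)
      H⊆F    : All (_∈ members F) H
      e∈H    : e ∈ H
      V      : Subset n
      ⋃H⊆V   : ⋃ H ⊆ V
      ∣V∣≡   : ∣ V ∣ ≡ m + suc k
      budget : 2 * ∣ ⋂ H ∣ + m * suc m ≤ 2 * k

  open Cover

  ∣e∣≡k : ∣ e ∣ ≡ k
  ∣e∣≡k = All.lookup uniform e∈F

  initial : k < n → Cover 0
  initial k<n with ∃-⊆-between {r = suc ∣ e ∣} (⊆⊤ {p = e}) (n≤1+n ∣ e ∣) 1+∣e∣≤∣⊤∣
    where
    1+∣e∣≤∣⊤∣ : suc ∣ e ∣ ≤ ∣ ⊤ {n} ∣
    1+∣e∣≤∣⊤∣ = subst₂ _<_ (sym ∣e∣≡k) (sym (∣⊤∣≡n n)) k<n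
  ... | V , e⊆V , _ , ∣V∣≡1+∣e∣ = cover (e ∷ []) (e∈F ∷ []) (here refl) V (∪-lub e⊆V ⊥⊆)
    (trans ∣V∣≡1+∣e∣ (cong suc ∣e∣≡k))
    (≤-trans (≤-reflexive (+-identityʳ _))
             (*-monoʳ-≤ 2 (≤-trans (∣p∩q∣≤∣p∣ e ⊤) (≤-reflexive ∣e∣≡k))))

  ⋃∷⊆∪ : ∀ {f V : Subset n} {H} → ⋃ H ⊆ V → ⋃ (f ∷ H) ⊆ f ∪ V
  ⋃∷⊆∪ {f} {V = V} ⋃H⊆V = ∪-lub (p⊆p∪q V) (⊆-trans ⋃H⊆V (q⊆p∪q f V))

  finish : ∀ {m f} (c : Cover m) → f ∈ members F → ∣ f ∩ ⋂ (H c) ∣ ≤ 1 →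
    ∣ f ∪ V c ∣ ≤ suc ∣ V c ∣ → Result
  finish {m} {f} c f∈F ∣f∩I∣≤1 grow =
    f ∷ H c , f∈F ∷ H⊆F c , there (e∈H c) , ∣f∩I∣≤1 , (begin
      ∣ f ∪ ⋃ (H c) ∣ ≤⟨ p⊆q⇒∣p∣≤∣q∣ (⋃∷⊆∪ {f} {H = H c} (⋃H⊆V c)) ⟩
      ∣ f ∪ V c ∣     ≤⟨ grow ⟩
      suc ∣ V c ∣     ≡⟨ cong suc (∣V∣≡ c) ⟩
      suc m + suc k   ≤⟨ +-monoˡ-≤ (suc k) (s≤s m≤t) ⟩
      suc t + suc k   ≡⟨ regroup t k ⟩
      k + t + 2       ∎)
    where
    open ≤-Reasoning
    m≤t : m ≤ t
    m≤t = m[1+m]≤n[1+n]⇒m≤n (≤-trans (m≤n+m _ _) (≤-trans (budget c) 2k≤t[1+t]))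
    regroup : ∀ t k → suc t + suc k ≡ k + t + 2
    regroup = solve-∀

  ∣f∪V∣≤1+∣V∣ : ∀ {f S V} → f ∈ members F → S ⊆ f → S ⊆ V → ∣ S ∣ ≡ r →
    ∣ f ∪ V ∣ ≤ suc ∣ V ∣
  ∣f∪V∣≤1+∣V∣ {f} {S} {V} f∈F S⊆f S⊆V ∣S∣≡r = +-cancelʳ-≤ r _ _
    (subst₂ _≤_ (cong (∣ f ∪ V ∣ +_) ∣S∣≡r)
                (trans (cong (_+ ∣ V ∣) (All.lookup uniform f∈F)) (cong suc (+-comm r ∣ V ∣)))
                (∣p∪q∣+∣s∣≤∣p∣+∣q∣ S⊆f S⊆V))

  ∣f∩I∣≤1 : ∀ {f S I} → f ∈ members F → S ⊆ f → S ⊆ ∁ I → ∣ S ∣ ≡ r → ∣ f ∩ I ∣ ≤ 1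
  ∣f∩I∣≤1 {f} {S} {I} f∈F S⊆f S⊆∁I ∣S∣≡r = +-cancelʳ-≤ r _ 1
    (subst₂ _≤_ (cong (∣ f ∩ I ∣ +_) ∣S∣≡r) (All.lookup uniform f∈F)
      (disjoint⇒∣p∣+∣q∣≤∣s∣ (p∩q⊆p f I) S⊆f (⊆-trans S⊆∁I (p⊆q⇒∁p⊇∁q (p∩q⊆q f I)))))

  step : ∀ {m} (c : Cover m) → Result ⊎ ∃₂ λ m′ (c′ : Cover m′) → ∣ ⋂ (H c′) ∣ < ∣ ⋂ (H c) ∣
  step {m} c with ∃-⊆-avoiding⊎covering r (V c) (⋂ (H c)) r≤∣V∣
    where
    r≤∣V∣ : r ≤ ∣ V c ∣
    r≤∣V∣ = subst (r ≤_) (sym (∣V∣≡ c)) (m≤n⇒m≤o+n m (≤-trans (n≤1+n r) (n≤1+n (suc r))))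
  ... | S , S⊆V , ∣S∣≡r , choice with ∃-member-⊇ {k = k} {F} codegree S ∣S∣≡r
  ... | f , f∈F , S⊆f with choice
  ...   | inj₁ S⊆∁I =
    inj₁ (finish c f∈F (∣f∩I∣≤1 f∈F S⊆f S⊆∁I ∣S∣≡r) (∣f∪V∣≤1+∣V∣ f∈F S⊆f S⊆V ∣S∣≡r))
  ...   | inj₂ V∖I⊆S with budget-step v≤v′ v′≤1+v shrink (budget c)
    where
    v≤v′ : m + suc k ≤ ∣ f ∪ V c ∣
    v≤v′ = subst (_≤ ∣ f ∪ V c ∣) (∣V∣≡ c) (∣q∣≤∣p∪q∣ f (V c))
    v′≤1+v : ∣ f ∪ V c ∣ ≤ suc m + suc k
    v′≤1+v = subst (∣ f ∪ V c ∣ ≤_) (cong suc (∣V∣≡ c)) (∣f∪V∣≤1+∣V∣ f∈F S⊆f S⊆V ∣S∣≡r)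
    shrink : ∣ f ∩ ⋂ (H c) ∣ + ∣ f ∪ V c ∣ ≤ k + ∣ ⋂ (H c) ∣
    shrink = subst (λ x → ∣ f ∩ ⋂ (H c) ∣ + ∣ f ∪ V c ∣ ≤ x + ∣ ⋂ (H c) ∣)
      (All.lookup uniform f∈F) (∣s∩q∣+∣s∪p∣≤∣s∣+∣q∣ (⊆-trans V∖I⊆S S⊆f))
  ... | m′ , ∣V′∣≡ , shrinks , budget′ = inj₂ (m′ , c′ , shrinks)
    where
    c′ : Cover m′
    c′ = cover (f ∷ H c) (f∈F ∷ H⊆F c) (there (e∈H c))
               (f ∪ V c) (⋃∷⊆∪ {f} {H = H c} (⋃H⊆V c)) ∣V′∣≡ budget′

  iterate : ∀ {m} (c : Cover m) → Acc _<_ ∣ ⋂ (H c) ∣ → Result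
  iterate c (acc smaller) with step c
  ... | inj₁ result = result
  ... | inj₂ (_ , c′ , shrinks) = iterate c′ (smaller shrinks)

lemma2p1 : (k n t : ℕ) → 2 ≤ k → IsCeilTri k t →
    (F : Family n) → Uniform k F → Intersecting F →
    k + t + 2 ≤ n → MinCodegreeAtLeast k F 1 →
    (e : Subset n) → e ∈ members F →
    Σ (List (Subset n)) (λ H →
      All (λ f → f ∈ members F) H × e ∈ H ×
      ∣ ⋂ H ∣ ≤ 1 × ∣ ⋃ H ∣ ≤ k + t + 2)
lemma2p1 (suc r) n t _ (8k+1≤[2t+1]² , _) F uniform _ k+t+2≤n codegree e e∈F =
  iterate (initial k<n) (<-wellFounded _)
  where
  open Greedy {t = t} F uniform codegree
    (8k+1≤[2t+1]²⇒2k≤t[1+t] (suc r) t 8k+1≤[2t+1]²) e∈F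
  k<n : suc r < n
  k<n = ≤-trans (≤-<-trans (m≤m+n (suc r) t) (m<m+n (suc r + t) z<s)) k+t+2≤n
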